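{- For any $A\in\mathbb{C}$ and any integer $n\ge2$, $$\det[v_{|j-k|}(A,-1)]_{1\le j,k\le n}=(-1)^{\lfloor (n-1)/2\rfloor}(2A)^{n-2}\times\begin{cases}4A&\text{if } n \text{ is odd},\\ 4-A^2&\text{if } n\text{ is even}.\end{cases}$$
   Context: For $x,y\in\mathbb{C}$, the Lucas sequence $(v_n(x,y))_{n\ge0}$ is defined by $v_0(x,y)=2$, $v_1(x,y)=x$, and $v_{n+1}(x,y)=xv_n(x,y)-yv_{n-1}(x,y)$ for $n\ge1$. The convention $0^0=1$ is used. -}

module Defs where

open import Level using (Level)
open import Algebra.Bundles using (CommutativeRing)
open import Data.Nat using (ℕ; zero; suc)
open import Data.Fin using (Fin; zero; suc; toℕ; punchIn)

-- All definitions are over an arbitrary commutative ring R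
-- (the identity is stated for every commutative ring, in particular ℂ).
module _ {c ℓ : Level} (R : CommutativeRing c ℓ) where
  open CommutativeRing R using (Carrier; _+_; _*_; -_; _-_; 0#; 1#)

  pow : Carrier → ℕ → Carrier
  pow x zero    = 1#
  pow x (suc k) = x * pow x k

  negOnePow : ℕ → Carrier
  negOnePow zero    = 1#
  negOnePow (suc k) = - negOnePow k

  lucasV : Carrier → Carrier → ℕ → Carrier
  lucasV x y zero          = 1# + 1#
  lucasV x y (suc zero)    = x
  lucasV x y (suc (suc n)) = x * lucasV x y (suc n) - y * lucasV x y n

  sumFin : (n : ℕ) → (Fin n → Carrier) → Carrier
  sumFin zero    f = 0#
  sumFin (suc n) f = f zero + sumFin n (λ i → f (suc i))

  det : (n : ℕ) → (Fin n → Fin n → Carrier) → Carrier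
  det zero    M = 1#
  det (suc n) M =
    sumFin (suc n) (λ j → negOnePow (toℕ j) * (M zero j *
      det n (λ r k → M (suc r) (punchIn j k))))

{-# OPTIONS --safe #-}
module Submission where

-- Write v n for v_n(A, -1), so that v (n + 2) = A v (n + 1) + v n, and τ = 2A. Let shifted g n be
-- the matrix toeplitz n = [v ∣j - k∣] with its first column replaced by (v g, v (g + 1), …), so that
-- shifted 0 n = toeplitz n. Subtracting A·(row 1) + (row 2) from row 0 of shifted g (m + 3) leaves
-- the row (- τ v (g + 1), - τ, 0, …, 0); expanding along it,
--   det (shifted g (m + 3)) = τ (det (shifted (g + 1) (m + 2)) - v (g + 1) det (toeplitz (m + 2))).
-- Induction on k then gives
--   det (shifted g (2k + 2)) = (-1)^k τ^(2k) (2 v g - A v (g + 1)),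
--   det (shifted g (2k + 3)) = (-1)^(k+1) τ^(2k+1) (A v g + 2 v (g + 1)),
-- and g = 0 is the theorem. The row operation rests on the determinant, defined by expansion along
-- the first row, vanishing when two rows agree; expanding along the first two rows, the terms of
-- such a determinant cancel in pairs.

open import Defs
open import Level using (Level)
open import Algebra.Bundles using (CommutativeRing)
open import Data.Nat using (ℕ; _≤_; _∸_; _/_; _%_; ∣_-_∣)
open import Data.Fin using (toℕ)
open import Data.Product using (_×_)
open import Relation.Binary.PropositionalEquality using (_≡_)

open import Data.Nat as ℕ using (zero; suc; s≤s; z≤n)
import Data.Nat.Properties as ℕ
open import Data.Nat.DivMod using (m*n%n≡0; [m+kn]%n≡m%n; m*n/n≡m; +-distrib-/-∣ʳ)
open import Data.Nat.Divisibility using (divides-refl)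
open import Data.Integer as ℤ using (ℤ; +_; -[1+_]; _⊖_)
import Data.Integer.Properties as ℤ
open import Data.Fin using (Fin; zero; suc; punchIn)
open import Data.Vec.Functional using (Vector; _∷_)
open import Data.Product using (∃-syntax; _,_)
open import Data.Sum using (_⊎_; inj₁; inj₂)
open import Data.Maybe using (just; nothing)
open import Function using (_∘_)
open import Relation.Nullary using (yes; no; contradiction)
open import Relation.Binary.Definitions using (WeaklyDecidable)
open import Relation.Binary.PropositionalEquality as ≡ using (_≗_)
open import Algebra.Solver.Ring.AlmostCommutativeRing using (fromCommutativeRing; _-Raw-AlmostCommutative⟶_)

-- Solving ring equations needs coefficients whose equality is decidable, so that cancelling
-- monomials are recognised; ℤ maps into every commutative ring.
module RingSolver {c ℓ : Level} (R : CommutativeRing c ℓ) where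
  open CommutativeRing R
  open import Algebra.Properties.Ring ring using (-‿distribˡ-*; -‿distribʳ-*; -‿+-comm; -‿involutive; -0#≈0#)
  open import Algebra.Properties.CommutativeSemigroup +-commutativeSemigroup using (interchange)
  open import Algebra.Properties.Semiring.Mult.TCOptimised semiring using (1+×; ×-homo-+; ×1-homo-*)
    renaming (_×_ to _×′_)
  open import Relation.Binary.Reasoning.Setoid setoid

  -- With the optimised _×′_, ⟦ + 1 ⟧ℤ is 1# and ⟦ + 2 ⟧ℤ is 1# + 1# on the nose, so the literals
  -- con (+ n) in solver expressions match the ring's own constants definitionally.
  ⟦_⟧ℤ : ℤ → Carrier
  ⟦ + n ⟧ℤ    = n ×′ 1#
  ⟦ -[1+ n ] ⟧ℤ = - (suc n ×′ 1#)

  -‿homo : ∀ i → ⟦ ℤ.- i ⟧ℤ ≈ - ⟦ i ⟧ℤ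
  -‿homo (+ zero)  = sym -0#≈0#
  -‿homo (+ suc n) = refl
  -‿homo -[1+ n ]  = sym (-‿involutive _)

  ⊖-homo : ∀ m n → ⟦ m ⊖ n ⟧ℤ ≈ m ×′ 1# - n ×′ 1#
  ⊖-homo zero    zero    = sym (-‿inverseʳ 0#)
  ⊖-homo zero    (suc n) = sym (+-identityˡ _)
  ⊖-homo (suc m) zero    = sym (trans (+-congˡ -0#≈0#) (+-identityʳ _))
  ⊖-homo (suc m) (suc n) = begin
    ⟦ suc m ⊖ suc n ⟧ℤ                     ≡⟨ ≡.cong ⟦_⟧ℤ (ℤ.[1+m]⊖[1+n]≡m⊖n m n) ⟩
    ⟦ m ⊖ n ⟧ℤ                              ≈⟨ ⊖-homo m n ⟩
    m ×′ 1# - n ×′ 1#                        ≈⟨ +-identityˡ _ ⟨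
    0# + (m ×′ 1# - n ×′ 1#)                 ≈⟨ +-congʳ (-‿inverseʳ 1#) ⟨
    (1# - 1#) + (m ×′ 1# - n ×′ 1#)          ≈⟨ interchange 1# (- 1#) (m ×′ 1#) (- (n ×′ 1#)) ⟩
    (1# + m ×′ 1#) + (- 1# - n ×′ 1#)
      ≈⟨ +-cong (1+× m 1#) (trans (-‿cong (1+× n 1#)) (sym (-‿+-comm 1# (n ×′ 1#)))) ⟨
    suc m ×′ 1# - suc n ×′ 1#                ∎

  +-homo : ∀ i j → ⟦ i ℤ.+ j ⟧ℤ ≈ ⟦ i ⟧ℤ + ⟦ j ⟧ℤ
  +-homo (+ m)    (+ n)    = ×-homo-+ 1# m n
  +-homo (+ m)    -[1+ n ] = ⊖-homo m (suc n)
  +-homo -[1+ m ] (+ n)    = trans (⊖-homo n (suc m)) (+-comm _ _)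
  +-homo -[1+ m ] -[1+ n ] = begin
    - (suc (suc (m ℕ.+ n)) ×′ 1#)           ≡⟨ ≡.cong (λ k → - (suc k ×′ 1#)) (≡.sym (ℕ.+-suc m n)) ⟩
    - ((suc m ℕ.+ suc n) ×′ 1#)             ≈⟨ -‿cong (×-homo-+ 1# (suc m) (suc n)) ⟩
    - (suc m ×′ 1# + suc n ×′ 1#)            ≈⟨ -‿+-comm _ _ ⟨
    - (suc m ×′ 1#) - suc n ×′ 1#            ∎

  *-homo-pos : ∀ m n → ⟦ + m ℤ.* + n ⟧ℤ ≈ ⟦ + m ⟧ℤ * ⟦ + n ⟧ℤ
  *-homo-pos m n = trans (reflexive (≡.cong ⟦_⟧ℤ (≡.sym (ℤ.pos-* m n)))) (×1-homo-* m n)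

  *-homo-posˡ : ∀ m j → ⟦ + m ℤ.* j ⟧ℤ ≈ ⟦ + m ⟧ℤ * ⟦ j ⟧ℤ
  *-homo-posˡ m (+ n)    = *-homo-pos m n
  *-homo-posˡ m -[1+ n ] = begin
    ⟦ + m ℤ.* -[1+ n ] ⟧ℤ                   ≡⟨ ≡.cong ⟦_⟧ℤ (ℤ.neg-distribʳ-* (+ m) (+ suc n)) ⟨
    ⟦ ℤ.- (+ m ℤ.* + suc n) ⟧ℤ              ≈⟨ -‿homo (+ m ℤ.* + suc n) ⟩
    - ⟦ + m ℤ.* + suc n ⟧ℤ                  ≈⟨ -‿cong (*-homo-pos m (suc n)) ⟩
    - (⟦ + m ⟧ℤ * ⟦ + suc n ⟧ℤ)             ≈⟨ -‿distribʳ-* _ _ ⟩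
    ⟦ + m ⟧ℤ * ⟦ -[1+ n ] ⟧ℤ                ∎

  *-homo : ∀ i j → ⟦ i ℤ.* j ⟧ℤ ≈ ⟦ i ⟧ℤ * ⟦ j ⟧ℤ
  *-homo (+ m)    j = *-homo-posˡ m j
  *-homo -[1+ m ] j = begin
    ⟦ -[1+ m ] ℤ.* j ⟧ℤ                     ≡⟨ ≡.cong ⟦_⟧ℤ (ℤ.neg-distribˡ-* (+ suc m) j) ⟨
    ⟦ ℤ.- (+ suc m ℤ.* j) ⟧ℤ                ≈⟨ -‿homo (+ suc m ℤ.* j) ⟩
    - ⟦ + suc m ℤ.* j ⟧ℤ                    ≈⟨ -‿cong (*-homo-posˡ (suc m) j) ⟩
    - (⟦ + suc m ⟧ℤ * ⟦ j ⟧ℤ)               ≈⟨ -‿distribˡ-* _ _ ⟩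
    ⟦ -[1+ m ] ⟧ℤ * ⟦ j ⟧ℤ                  ∎

  ℤ⟶R : ℤ.+-*-rawRing -Raw-AlmostCommutative⟶ fromCommutativeRing R
  ℤ⟶R = record
    { ⟦_⟧    = ⟦_⟧ℤ
    ; +-homo = +-homo
    ; *-homo = *-homo
    ; -‿homo = -‿homo
    ; 0-homo = refl
    ; 1-homo = refl
    }

  ⟦⟧ℤ-≈? : WeaklyDecidable (λ i j → ⟦ i ⟧ℤ ≈ ⟦ j ⟧ℤ)
  ⟦⟧ℤ-≈? i j with i ℤ.≟ j
  ... | yes ≡.refl = just refl
  ... | no _       = nothing

  open import Algebra.Solver.Ring ℤ.+-*-rawRing (fromCommutativeRing R) ℤ⟶R ⟦⟧ℤ-≈? public

module Determinant {c ℓ : Level} (R : CommutativeRing c ℓ) where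
  open CommutativeRing R hiding (zero)
  open import Algebra.Properties.Ring ring using (-‿+-comm; -0#≈0#; -‿distribˡ-*)
  open import Algebra.Properties.CommutativeSemigroup +-commutativeSemigroup using (interchange)
  open import Relation.Binary.Reasoning.Setoid setoid
  open RingSolver R using (solve; _:=_; _:+_; _:*_; :-_; _:-_; con)

  Matrix : ℕ → Set c
  Matrix n = Fin n → Vector Carrier n

  cofactorSign : ∀ {n} → Fin n → Carrier
  cofactorSign j = negOnePow R (toℕ j)

  minor : ∀ {n} → Matrix (suc n) → Fin (suc n) → Matrix n
  minor M j r k = M (suc r) (punchIn j k)

  cofactorTerm : ∀ {n} → Matrix (suc n) → Fin (suc n) → Carrier
  cofactorTerm {n} M j = cofactorSign j * (M zero j * det R n (minor M j))

  sumFin-cong : ∀ {n} {f g : Vector Carrier n} → (∀ i → f i ≈ g i) → sumFin R n f ≈ sumFin R n g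
  sumFin-cong {zero}  f≈g = refl
  sumFin-cong {suc n} f≈g = +-cong (f≈g zero) (sumFin-cong (f≈g ∘ suc))

  sumFin-0 : ∀ {n} {f : Vector Carrier n} → (∀ i → f i ≈ 0#) → sumFin R n f ≈ 0#
  sumFin-0 {zero}  f≈0 = refl
  sumFin-0 {suc n} f≈0 = trans (+-cong (f≈0 zero) (sumFin-0 (f≈0 ∘ suc))) (+-identityˡ 0#)

  sumFin-+ : ∀ {n} (f g : Vector Carrier n) → sumFin R n (λ i → f i + g i) ≈ sumFin R n f + sumFin R n g
  sumFin-+ {zero}  f g = sym (+-identityˡ 0#)
  sumFin-+ {suc n} f g = trans (+-congˡ (sumFin-+ (f ∘ suc) (g ∘ suc))) (interchange _ _ _ _)

  sumFin-*ˡ : ∀ {n} x (f : Vector Carrier n) → sumFin R n (λ i → x * f i) ≈ x * sumFin R n f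
  sumFin-*ˡ {zero}  x f = sym (zeroʳ x)
  sumFin-*ˡ {suc n} x f = trans (+-congˡ (sumFin-*ˡ x (f ∘ suc))) (sym (distribˡ x _ _))

  sumFin-neg : ∀ {n} (f : Vector Carrier n) → sumFin R n (λ i → - f i) ≈ - sumFin R n f
  sumFin-neg {zero}  f = sym -0#≈0#
  sumFin-neg {suc n} f = trans (+-congˡ (sumFin-neg (f ∘ suc))) (-‿+-comm _ _)

  det-cong : ∀ {n} {M N : Matrix n} → (∀ i j → M i j ≈ N i j) → det R n M ≈ det R n N
  det-cong {zero}  M≈N = refl
  det-cong {suc n} {M} {N} M≈N = sumFin-cong {f = cofactorTerm M} {g = cofactorTerm N} λ j →
    *-congˡ (*-cong (M≈N zero j) (det-cong λ r k → M≈N (suc r) (punchIn j k)))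

  det-∷-columns : ∀ {m n} (x : Vector Carrier n) (K : Fin m → Vector Carrier n) (f : Fin (suc m) → Fin n) →
    det R (suc m) (λ r k → (x ∷ K) r (f k)) ≈ det R (suc m) ((x ∘ f) ∷ λ r → K r ∘ f)
  det-∷-columns x K f =
    det-cong {M = λ r k → (x ∷ K) r (f k)} {N = (x ∘ f) ∷ λ r → K r ∘ f} λ { zero k → refl ; (suc r) k → refl }

  det-linear-row₀ : ∀ {n} (x y : Vector Carrier (suc n)) α (K : Fin n → Vector Carrier (suc n)) →
    det R (suc n) ((λ k → x k + α * y k) ∷ K) ≈ det R (suc n) (x ∷ K) + α * det R (suc n) (y ∷ K)
  det-linear-row₀ x y α K =
    trans (sumFin-cong λ j → expand (cofactorSign j) (x j) (y j) (det R _ (minor (x ∷ K) j)))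
          (trans (sumFin-+ (cofactorTerm (x ∷ K)) (λ j → α * cofactorTerm (y ∷ K) j))
                 (+-congˡ (sumFin-*ˡ α (cofactorTerm (y ∷ K)))))
    where
    expand : ∀ s x y d → s * ((x + α * y) * d) ≈ s * (x * d) + α * (s * (y * d))
    expand = solve 5 (λ α s x y d → s :* ((x :+ α :* y) :* d) := s :* (x :* d) :+ α :* (s :* (y :* d))) refl α

  det-linear-row₁ : ∀ {n} (a x y : Vector Carrier (suc (suc n))) α (K : Fin n → Vector Carrier (suc (suc n))) →
    det R (suc (suc n)) (a ∷ (λ k → x k + α * y k) ∷ K)
      ≈ det R (suc (suc n)) (a ∷ x ∷ K) + α * det R (suc (suc n)) (a ∷ y ∷ K)
  det-linear-row₁ {n} a x y α K =
    trans (sumFin-cong λ j → trans (*-congˡ (*-congˡ (minor-linear j))) (expand (cofactorSign j) (a j) _ _))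
          (trans (sumFin-+ (cofactorTerm (a ∷ x ∷ K)) (λ j → α * cofactorTerm (a ∷ y ∷ K) j))
                 (+-congˡ (sumFin-*ˡ α (cofactorTerm (a ∷ y ∷ K)))))
    where
    minor-linear : ∀ j → det R (suc _) (minor (a ∷ (λ k → x k + α * y k) ∷ K) j)
                       ≈ det R (suc _) (minor (a ∷ x ∷ K) j) + α * det R (suc _) (minor (a ∷ y ∷ K) j)
    minor-linear j = begin
      det R _ (minor (a ∷ (λ k → x k + α * y k) ∷ K) j)     ≈⟨ det-∷-columns (λ k → x k + α * y k) K (punchIn j) ⟩
      det R _ ((λ k → xⱼ k + α * yⱼ k) ∷ Kⱼ)                ≈⟨ det-linear-row₀ xⱼ yⱼ α Kⱼ ⟩
      det R _ (xⱼ ∷ Kⱼ) + α * det R _ (yⱼ ∷ Kⱼ)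
        ≈⟨ +-cong (det-∷-columns x K (punchIn j)) (*-congˡ (det-∷-columns y K (punchIn j))) ⟨
      det R _ (minor (a ∷ x ∷ K) j) + α * det R _ (minor (a ∷ y ∷ K) j) ∎
      where
      xⱼ yⱼ : Vector Carrier (suc n)
      xⱼ = x ∘ punchIn j
      yⱼ = y ∘ punchIn j
      Kⱼ : Fin n → Vector Carrier (suc n)
      Kⱼ = λ r → K r ∘ punchIn j
    expand : ∀ s a p q → s * (a * (p + α * q)) ≈ s * (a * p) + α * (s * (a * q))
    expand = solve 5 (λ α s a p q → s :* (a :* (p :+ α :* q)) := s :* (a :* p) :+ α :* (s :* (a :* q))) refl α

  -- The expansion along the first two rows of a determinant whose first two rows are both x;
  -- G f stands for the determinant of the remaining rows restricted to the columns f.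
  doubleExpansion : ∀ {m} → Vector Carrier (suc (suc m)) → ((Fin m → Fin (suc (suc m))) → Carrier) → Carrier
  doubleExpansion {m} x G = sumFin R (suc (suc m)) λ j → cofactorSign j * (x j *
    sumFin R (suc m) λ k → cofactorSign k * (x (punchIn j k) * G (punchIn j ∘ punchIn k)))

  -- The terms in which one of the two rows uses column 0 cancel in pairs:
  -- (j, k) = (0, k) against (k + 1, 0).
  doubleExpansion-peel : ∀ {m} x G → doubleExpansion {m} x G
    ≈ sumFin R (suc m) λ j → - cofactorSign j * (x (suc j) *
        sumFin R m λ k → - cofactorSign k * (x (suc (punchIn j k)) * G (punchIn (suc j) ∘ punchIn (suc k))))
  doubleExpansion-peel {m} x G = begin
    1# * (x₀ * V) + sumFin R (suc m) (λ j → - s j * (x (suc j) * (1# * (x₀ * W j) + rest j)))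
      ≈⟨ +-cong (*-identityˡ _) (sumFin-cong λ j → split (s j) (x (suc j)) (W j) (rest j)) ⟩
    x₀ * V + sumFin R (suc m) (λ j → - (x₀ * (s j * (x (suc j) * W j))) + - s j * (x (suc j) * rest j))
      ≈⟨ +-congˡ (sumFin-+ (λ j → - (x₀ * (s j * (x (suc j) * W j)))) (λ j → - s j * (x (suc j) * rest j))) ⟩
    x₀ * V + (sumFin R (suc m) (λ j → - (x₀ * (s j * (x (suc j) * W j)))) + restSum)
      ≈⟨ +-congˡ (+-congʳ (trans (sumFin-neg (λ j → x₀ * (s j * (x (suc j) * W j))))
                                 (-‿cong (sumFin-*ˡ x₀ (λ j → s j * (x (suc j) * W j)))))) ⟩
    x₀ * V + (- (x₀ * V) + restSum)
      ≈⟨ cancel (x₀ * V) restSum ⟩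
    restSum ∎
    where
    s : Fin (suc m) → Carrier
    s = cofactorSign
    x₀ : Carrier
    x₀ = x zero
    W : Fin (suc m) → Carrier
    W j = G (suc ∘ punchIn j)
    V : Carrier
    V = sumFin R (suc m) λ j → s j * (x (suc j) * W j)
    rest : Fin (suc m) → Carrier
    rest j = sumFin R m λ k → - cofactorSign k * (x (suc (punchIn j k)) * G (punchIn (suc j) ∘ punchIn (suc k)))
    restSum : Carrier
    restSum = sumFin R (suc m) λ j → - s j * (x (suc j) * rest j)
    split : ∀ s y w r → - s * (y * (1# * (x₀ * w) + r)) ≈ - (x₀ * (s * (y * w))) + - s * (y * r)
    split = solve 5 (λ a s y w r →
      :- s :* (y :* (con (+ 1) :* (a :* w) :+ r)) := :- (a :* (s :* (y :* w))) :+ :- s :* (y :* r)) refl x₀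
    cancel : ∀ a b → a + (- a + b) ≈ b
    cancel = solve 2 (λ a b → a :+ (:- a :+ b) := b) refl

  -- What survives the peeling is the double expansion of x ∘ suc, with G restricted to column maps fixing 0.
  doubleExpansion-vanishes : ∀ {m} x G → (∀ {f g} → f ≗ g → G f ≈ G g) → doubleExpansion {m} x G ≈ 0#
  doubleExpansion-vanishes {zero} x G _ =
    trans (doubleExpansion-peel x G)
          (sumFin-0 {f = λ j → - cofactorSign j * (x (suc j) * 0#)} λ j → trans (*-congˡ (zeroʳ _)) (zeroʳ _))
  doubleExpansion-vanishes {suc m} x G G-resp =
    trans (doubleExpansion-peel x G) (trans (sumFin-cong term) (doubleExpansion-vanishes (x ∘ suc) G′ G′-resp))
    where
    G′ : (Fin m → Fin (suc (suc m))) → Carrier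
    G′ f = G (zero ∷ suc ∘ f)
    G′-resp : ∀ {f g} → f ≗ g → G′ f ≈ G′ g
    G′-resp f≗g = G-resp λ { zero → ≡.refl ; (suc l) → ≡.cong suc (f≗g l) }
    inner : Fin (suc (suc m)) → Fin (suc m) → Carrier
    inner j k = cofactorSign k * (x (suc (punchIn j k)) * G′ (punchIn j ∘ punchIn k))
    term : ∀ j → - cofactorSign j * (x (suc j) * sumFin R (suc m) λ k →
                   - cofactorSign k * (x (suc (punchIn j k)) * G (punchIn (suc j) ∘ punchIn (suc k))))
               ≈ cofactorSign j * (x (suc j) * sumFin R (suc m) (inner j))
    term j = trans (*-congˡ (*-congˡ (trans (sumFin-cong λ k → reassociate k) (sumFin-neg (inner j)))))
                   (neg-neg (cofactorSign j) (x (suc j)) _)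
      where
      reassociate : ∀ k → - cofactorSign k * (x (suc (punchIn j k)) * G (punchIn (suc j) ∘ punchIn (suc k))) ≈ - inner j k
      reassociate k =
        trans (*-congˡ (*-congˡ (G-resp λ { zero → ≡.refl ; (suc l) → ≡.refl }))) (sym (-‿distribˡ-* _ _))
      neg-neg : ∀ s y t → - s * (y * - t) ≈ s * (y * t)
      neg-neg = solve 3 (λ s y t → :- s :* (y :* :- t) := s :* (y :* t)) refl

  det-row₀≡row₁ : ∀ {m} (N : Fin (suc m) → Vector Carrier (suc (suc m))) → det R (suc (suc m)) (N zero ∷ N) ≈ 0#
  det-row₀≡row₁ {m} N = doubleExpansion-vanishes (N zero) (λ f → det R m (λ r l → N (suc r) (f l)))
    λ {f} {g} f≗g → det-cong {M = λ r l → N (suc r) (f l)} {N = λ r l → N (suc r) (g l)}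
                              λ r l → reflexive (≡.cong (N (suc r)) (f≗g l))

  det-swap₀₁ : ∀ {m} (x y : Vector Carrier (suc (suc m))) (K : Fin m → Vector Carrier (suc (suc m))) →
    det R (suc (suc m)) (x ∷ y ∷ K) + det R (suc (suc m)) (y ∷ x ∷ K) ≈ 0#
  det-swap₀₁ {m} x y K = begin
    a + b                                           ≈⟨ collect a b ⟨
    (0# + 1# * a) + 1# * (b + 1# * 0#)
      ≈⟨ +-cong (+-congʳ (det-row₀≡row₁ (x ∷ K))) (*-congˡ (+-congˡ (*-congˡ (det-row₀≡row₁ (y ∷ K))))) ⟨
    (D (x ∷ x ∷ K) + 1# * a) + 1# * (b + 1# * D (y ∷ y ∷ K))
      ≈⟨ +-cong (det-linear-row₁ x x y 1# K) (*-congˡ (det-linear-row₁ y x y 1# K)) ⟨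
    D (x ∷ u ∷ K) + 1# * D (y ∷ u ∷ K)              ≈⟨ det-linear-row₀ x y 1# (u ∷ K) ⟨
    D (u ∷ u ∷ K)                                   ≈⟨ det-row₀≡row₁ (u ∷ K) ⟩
    0#                                              ∎
    where
    D : Matrix (suc (suc m)) → Carrier
    D = det R (suc (suc m))
    a b : Carrier
    a = D (x ∷ y ∷ K)
    b = D (y ∷ x ∷ K)
    u : Vector Carrier (suc (suc m))
    u = λ k → x k + 1# * y k
    collect : ∀ a b → (0# + 1# * a) + 1# * (b + 1# * 0#) ≈ a + b
    collect = solve 2 (λ a b →
      (con (+ 0) :+ con (+ 1) :* a) :+ con (+ 1) :* (b :+ con (+ 1) :* con (+ 0)) := a :+ b) refl

  det-swap₁₂ : ∀ {m} (a x y : Vector Carrier (suc (suc (suc m)))) (K : Fin m → Vector Carrier (suc (suc (suc m)))) →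
    det R (suc (suc (suc m))) (a ∷ x ∷ y ∷ K) + det R (suc (suc (suc m))) (a ∷ y ∷ x ∷ K) ≈ 0#
  det-swap₁₂ {m} a x y K =
    trans (sym (sumFin-+ (cofactorTerm (a ∷ x ∷ y ∷ K)) (cofactorTerm (a ∷ y ∷ x ∷ K))))
          (sumFin-0 λ j → trans (factor (cofactorSign j) (a j) _ _)
                                (trans (*-congˡ (*-congˡ (minors-cancel j))) (trans (*-congˡ (zeroʳ _)) (zeroʳ _))))
    where
    factor : ∀ s a p q → s * (a * p) + s * (a * q) ≈ s * (a * (p + q))
    factor = solve 4 (λ s a p q → s :* (a :* p) :+ s :* (a :* q) := s :* (a :* (p :+ q))) refl
    restrict : ∀ (x y : Vector Carrier (suc (suc (suc m)))) j →
      det R (suc (suc m)) (minor (a ∷ x ∷ y ∷ K) j)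
        ≈ det R (suc (suc m)) ((x ∘ punchIn j) ∷ (y ∘ punchIn j) ∷ λ r → K r ∘ punchIn j)
    restrict x y j =
      det-cong {M = minor (a ∷ x ∷ y ∷ K) j} {N = (x ∘ punchIn j) ∷ (y ∘ punchIn j) ∷ λ r → K r ∘ punchIn j}
               λ { zero k → refl ; (suc zero) k → refl ; (suc (suc r)) k → refl }
    minors-cancel : ∀ j →
      det R (suc (suc m)) (minor (a ∷ x ∷ y ∷ K) j) + det R (suc (suc m)) (minor (a ∷ y ∷ x ∷ K) j) ≈ 0#
    minors-cancel j = trans (+-cong (restrict x y j) (restrict y x j))
                            (det-swap₀₁ (x ∘ punchIn j) (y ∘ punchIn j) (λ r → K r ∘ punchIn j))

  det-row₀≡row₂ : ∀ {m} (N : Fin (suc (suc m)) → Vector Carrier (suc (suc (suc m)))) →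
    det R (suc (suc (suc m))) (N (suc zero) ∷ N) ≈ 0#
  det-row₀≡row₂ {m} N = begin
    D (y ∷ N)                             ≈⟨ det-cong {M = y ∷ N} {N = y ∷ x ∷ y ∷ K} rows ⟩
    D (y ∷ x ∷ y ∷ K)                     ≈⟨ +-identityʳ _ ⟨
    D (y ∷ x ∷ y ∷ K) + 0#                ≈⟨ +-congˡ (det-row₀≡row₁ (y ∷ x ∷ K)) ⟨
    D (y ∷ x ∷ y ∷ K) + D (y ∷ y ∷ x ∷ K) ≈⟨ det-swap₁₂ y x y K ⟩
    0#                                    ∎
    where
    D : Matrix (suc (suc (suc m))) → Carrier
    D = det R (suc (suc (suc m)))
    x y : Vector Carrier (suc (suc (suc m)))
    x = N zero
    y = N (suc zero)
    K : Fin m → Vector Carrier (suc (suc (suc m)))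
    K = λ r → N (suc (suc r))
    rows : ∀ i k → (y ∷ N) i k ≈ (y ∷ x ∷ y ∷ K) i k
    rows zero                k = refl
    rows (suc zero)          k = refl
    rows (suc (suc zero))    k = refl
    rows (suc (suc (suc r))) k = refl

  det-add-rows₁₂-to-row₀ : ∀ {m} (w : Vector Carrier (suc (suc (suc m)))) α β
    (N : Fin (suc (suc m)) → Vector Carrier (suc (suc (suc m)))) →
    det R (suc (suc (suc m))) ((λ k → w k + α * N zero k + β * N (suc zero) k) ∷ N) ≈ det R (suc (suc (suc m))) (w ∷ N)
  det-add-rows₁₂-to-row₀ {m} w α β N = begin
    D ((λ k → w k + α * N zero k + β * N (suc zero) k) ∷ N)
      ≈⟨ det-linear-row₀ (λ k → w k + α * N zero k) (N (suc zero)) β N ⟩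
    D ((λ k → w k + α * N zero k) ∷ N) + β * D (N (suc zero) ∷ N)
      ≈⟨ +-congʳ (det-linear-row₀ w (N zero) α N) ⟩
    D (w ∷ N) + α * D (N zero ∷ N) + β * D (N (suc zero) ∷ N)
      ≈⟨ +-cong (+-congˡ (*-congˡ (det-row₀≡row₁ N))) (*-congˡ (det-row₀≡row₂ N)) ⟩
    D (w ∷ N) + α * 0# + β * 0#
      ≈⟨ drop-zeros (D (w ∷ N)) α β ⟩
    D (w ∷ N) ∎
    where
    D : Matrix (suc (suc (suc m))) → Carrier
    D = det R (suc (suc (suc m)))
    drop-zeros : ∀ d α β → d + α * 0# + β * 0# ≈ d
    drop-zeros = solve 3 (λ d α β → d :+ α :* con (+ 0) :+ β :* con (+ 0) := d) refl

  det-row₀-two-nonzero : ∀ {m} (M : Matrix (suc (suc m))) → (∀ k → M zero (suc (suc k)) ≈ 0#) →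
    det R (suc (suc m)) M
      ≈ M zero zero * det R (suc m) (minor M zero) - M zero (suc zero) * det R (suc m) (minor M (suc zero))
  det-row₀-two-nonzero {m} M zeros =
    trans (+-congˡ (+-congˡ (sumFin-0 {f = λ k → cofactorTerm M (suc (suc k))} λ k →
                               trans (*-congˡ (trans (*-congʳ (zeros k)) (zeroˡ _))) (zeroʳ _))))
          (two-terms _ _ _ _)
    where
    two-terms : ∀ a p b q → 1# * (a * p) + (- 1# * (b * q) + 0#) ≈ a * p - b * q
    two-terms = solve 4 (λ a p b q →
      con (+ 1) :* (a :* p) :+ (:- con (+ 1) :* (b :* q) :+ con (+ 0)) := a :* p :- b :* q) refl

  det₁ : (M : Matrix 1) → det R 1 M ≈ M zero zero
  det₁ M = trans (+-identityʳ _) (trans (*-identityˡ _) (*-identityʳ _))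

module LucasToeplitz {c ℓ : Level} (R : CommutativeRing c ℓ) (A : CommutativeRing.Carrier R) where
  open CommutativeRing R hiding (zero)
  open Determinant R
  open RingSolver R using (solve; _:=_; _:+_; _:*_; :-_; _:-_; con)
  open import Relation.Binary.Reasoning.Setoid setoid

  2# : Carrier
  2# = 1# + 1#

  τ : Carrier
  τ = 2# * A

  -- v (suc (suc n)) unfolds to A * v (suc n) - - 1# * v n; the solver calls below spell this out.
  v : ℕ → Carrier
  v = lucasV R A (- 1#)

  toeplitz : (n : ℕ) → Matrix n
  toeplitz n j k = v ∣ toℕ j - toℕ k ∣

  shifted : ℕ → (n : ℕ) → Matrix n
  shifted g (suc n) i = v (toℕ i ℕ.+ g) ∷ λ c → v ∣ toℕ i - suc (toℕ c) ∣

  detT : ℕ → Carrier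
  detT n = det R n (toeplitz n)

  detS : ℕ → ℕ → Carrier
  detS g n = det R n (shifted g n)

  detT≈detS₀ : ∀ n → detT n ≈ detS 0 n
  detT≈detS₀ zero    = refl
  detT≈detS₀ (suc n) = det-cong {M = toeplitz (suc n)} {N = shifted 0 (suc n)} λ i →
    λ { zero    → reflexive (≡.cong v (≡.trans (ℕ.∣-∣-identityʳ (toℕ i)) (≡.sym (ℕ.+-identityʳ (toℕ i)))))
      ; (suc c) → refl }

  detS-step : ∀ g m → detS g (3 ℕ.+ m) ≈ τ * (detS (suc g) (2 ℕ.+ m) - v (suc g) * detT (2 ℕ.+ m))
  detS-step g m = begin
    D₃ (shifted g (3 ℕ.+ m))          ≈⟨ det-cong {M = shifted g (3 ℕ.+ m)} {N = row₀-expanded ∷ N} rows ⟩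
    D₃ (row₀-expanded ∷ N)            ≈⟨ det-add-rows₁₂-to-row₀ w A 1# N ⟩
    D₃ (w ∷ N)                        ≈⟨ det-row₀-two-nonzero (w ∷ N) (λ k → refl) ⟩
    - (τ * v (suc g)) * detT (2 ℕ.+ m) - - τ * D₂ (minor (w ∷ N) (suc zero))
      ≈⟨ +-congˡ (-‿cong (*-congˡ (det-cong {M = minor (w ∷ N) (suc zero)} {N = shifted (suc g) (2 ℕ.+ m)} minor₁))) ⟩
    - (τ * v (suc g)) * detT (2 ℕ.+ m) - - τ * detS (suc g) (2 ℕ.+ m)
      ≈⟨ rearrange A (v (suc g)) (detT (2 ℕ.+ m)) (detS (suc g) (2 ℕ.+ m)) ⟩
    τ * (detS (suc g) (2 ℕ.+ m) - v (suc g) * detT (2 ℕ.+ m)) ∎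
    where
    D₂ : Matrix (2 ℕ.+ m) → Carrier
    D₂ = det R (2 ℕ.+ m)
    D₃ : Matrix (3 ℕ.+ m) → Carrier
    D₃ = det R (3 ℕ.+ m)
    N : Fin (2 ℕ.+ m) → Vector Carrier (3 ℕ.+ m)
    N r = shifted g (3 ℕ.+ m) (suc r)
    w : Vector Carrier (3 ℕ.+ m)
    w zero          = - (τ * v (suc g))
    w (suc zero)    = - τ
    w (suc (suc k)) = 0#
    row₀-expanded : Vector Carrier (3 ℕ.+ m)
    row₀-expanded k = w k + A * N zero k + 1# * N (suc zero) k
    rows : ∀ i k → shifted g (3 ℕ.+ m) i k ≈ (row₀-expanded ∷ N) i k
    rows zero zero = solve 3 (λ A v₀ v₁ →
      v₀ := :- (con (+ 2) :* A :* v₁) :+ A :* v₁ :+ con (+ 1) :* (A :* v₁ :- :- con (+ 1) :* v₀)) refl A (v g) (v (suc g))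
    rows zero (suc zero) = solve 1 (λ A →
      A := :- (con (+ 2) :* A) :+ A :* con (+ 2) :+ con (+ 1) :* A) refl A
    rows zero (suc (suc zero)) = solve 1 (λ A →
      A :* A :- :- con (+ 1) :* con (+ 2) := con (+ 0) :+ A :* A :+ con (+ 1) :* con (+ 2)) refl A
    rows zero (suc (suc (suc k))) = solve 3 (λ A v₁ v₂ →
      A :* v₂ :- :- con (+ 1) :* v₁ := con (+ 0) :+ A :* v₂ :+ con (+ 1) :* v₁)
      refl A (v (suc (toℕ k))) (v (2 ℕ.+ toℕ k))
    rows (suc r) k = refl
    minor₁ : ∀ r k → minor (w ∷ N) (suc zero) r k ≈ shifted (suc g) (2 ℕ.+ m) r k
    minor₁ r zero    = reflexive (≡.cong v (≡.sym (ℕ.+-suc (toℕ r) g)))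
    minor₁ r (suc k) = refl
    rearrange : ∀ A v₁ t s → - (2# * A * v₁) * t - - (2# * A) * s ≈ 2# * A * (s - v₁ * t)
    rearrange = solve 4 (λ A v₁ t s →
      :- (con (+ 2) :* A :* v₁) :* t :- :- (con (+ 2) :* A) :* s := con (+ 2) :* A :* (s :- v₁ :* t)) refl

  mutual
    detS-even : ∀ k g → detS g (2 ℕ.+ k ℕ.* 2) ≈ (negOnePow R k * pow R τ (k ℕ.* 2)) * (2# * v g - A * v (suc g))
    detS-even zero g = begin
      detS g 2                                                  ≈⟨ det-row₀-two-nonzero (shifted g 2) (λ ()) ⟩
      v g * det R 1 (minor (shifted g 2) zero) - A * det R 1 (minor (shifted g 2) (suc zero))
        ≈⟨ +-cong (*-congˡ (det₁ (minor (shifted g 2) zero)))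
                  (-‿cong (*-congˡ (det₁ (minor (shifted g 2) (suc zero))))) ⟩
      v g * 2# - A * v (suc g)                                   ≈⟨ base A (v g) (v (suc g)) ⟩
      (1# * 1#) * (2# * v g - A * v (suc g))                     ∎
      where
      base : ∀ A v₀ v₁ → v₀ * 2# - A * v₁ ≈ (1# * 1#) * (2# * v₀ - A * v₁)
      base = solve 3 (λ A v₀ v₁ →
        v₀ :* con (+ 2) :- A :* v₁ := con (+ 1) :* con (+ 1) :* (con (+ 2) :* v₀ :- A :* v₁)) refl
    detS-even (suc k) g = begin
      detS g (4 ℕ.+ k ℕ.* 2)                                     ≈⟨ detS-step g (suc (k ℕ.* 2)) ⟩
      τ * (detS (suc g) (3 ℕ.+ k ℕ.* 2) - v (suc g) * detT (3 ℕ.+ k ℕ.* 2))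
        ≈⟨ *-congˡ (+-cong (detS-odd k (suc g))
                           (-‿cong (*-congˡ (trans (detT≈detS₀ (3 ℕ.+ k ℕ.* 2)) (detS-odd k 0))))) ⟩
      τ * (c′ * (A * v (suc g) + 2# * v (2 ℕ.+ g)) - v (suc g) * (c′ * (A * 2# + 2# * A)))
        ≈⟨ step (negOnePow R k) (pow R τ (k ℕ.* 2)) A (v g) (v (suc g)) ⟩
      (negOnePow R (suc k) * pow R τ (suc k ℕ.* 2)) * (2# * v g - A * v (suc g)) ∎
      where
      c′ : Carrier
      c′ = negOnePow R (suc k) * pow R τ (suc (k ℕ.* 2))
      step : ∀ s p A v₀ v₁ → let τ = 2# * A ; c = - s * (τ * p) in
        τ * (c * (A * v₁ + 2# * (A * v₁ - - 1# * v₀)) - v₁ * (c * (A * 2# + 2# * A)))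
          ≈ (- s * (τ * (τ * p))) * (2# * v₀ - A * v₁)
      step = solve 5 (λ s p A v₀ v₁ → let τ = con (+ 2) :* A ; c = :- s :* (τ :* p) in
        τ :* (c :* (A :* v₁ :+ con (+ 2) :* (A :* v₁ :- :- con (+ 1) :* v₀))
              :- v₁ :* (c :* (A :* con (+ 2) :+ con (+ 2) :* A)))
          := (:- s :* (τ :* (τ :* p))) :* (con (+ 2) :* v₀ :- A :* v₁)) refl

    detS-odd : ∀ k g →
      detS g (3 ℕ.+ k ℕ.* 2) ≈ (negOnePow R (suc k) * pow R τ (suc (k ℕ.* 2))) * (A * v g + 2# * v (suc g))
    detS-odd k g = begin
      detS g (3 ℕ.+ k ℕ.* 2)                                     ≈⟨ detS-step g (k ℕ.* 2) ⟩
      τ * (detS (suc g) (2 ℕ.+ k ℕ.* 2) - v (suc g) * detT (2 ℕ.+ k ℕ.* 2))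
        ≈⟨ *-congˡ (+-cong (detS-even k (suc g))
                           (-‿cong (*-congˡ (trans (detT≈detS₀ (2 ℕ.+ k ℕ.* 2)) (detS-even k 0))))) ⟩
      τ * (c′ * (2# * v (suc g) - A * v (2 ℕ.+ g)) - v (suc g) * (c′ * (2# * 2# - A * A)))
        ≈⟨ step (negOnePow R k) (pow R τ (k ℕ.* 2)) A (v g) (v (suc g)) ⟩
      (negOnePow R (suc k) * pow R τ (suc (k ℕ.* 2))) * (A * v g + 2# * v (suc g)) ∎
      where
      c′ : Carrier
      c′ = negOnePow R k * pow R τ (k ℕ.* 2)
      step : ∀ s p A v₀ v₁ → let τ = 2# * A ; c = s * p in
        τ * (c * (2# * v₁ - A * (A * v₁ - - 1# * v₀)) - v₁ * (c * (2# * 2# - A * A)))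
          ≈ (- s * (τ * p)) * (A * v₀ + 2# * v₁)
      step = solve 5 (λ s p A v₀ v₁ → let τ = con (+ 2) :* A ; c = s :* p in
        τ :* (c :* (con (+ 2) :* v₁ :- A :* (A :* v₁ :- :- con (+ 1) :* v₀))
              :- v₁ :* (c :* (con (+ 2) :* con (+ 2) :- A :* A)))
          := (:- s :* (τ :* p)) :* (A :* v₀ :+ con (+ 2) :* v₁)) refl

  detT-even : ∀ k → detT (2 ℕ.+ k ℕ.* 2) ≈ (negOnePow R k * pow R τ (k ℕ.* 2)) * ((2# + 2#) - A * A)
  detT-even k = trans (detT≈detS₀ (2 ℕ.+ k ℕ.* 2)) (trans (detS-even k 0) (*-congˡ (four-minus-square A)))
    where
    four-minus-square : ∀ A → 2# * 2# - A * A ≈ (2# + 2#) - A * A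
    four-minus-square = solve 1 (λ A → con (+ 2) :* con (+ 2) :- A :* A := con (+ 2) :+ con (+ 2) :- A :* A) refl

  detT-odd : ∀ k → detT (3 ℕ.+ k ℕ.* 2) ≈ (negOnePow R (suc k) * pow R τ (suc (k ℕ.* 2))) * ((2# + 2#) * A)
  detT-odd k = trans (detT≈detS₀ (3 ℕ.+ k ℕ.* 2)) (trans (detS-odd k 0) (*-congˡ (four-times A)))
    where
    four-times : ∀ A → A * 2# + 2# * A ≈ (2# + 2#) * A
    four-times = solve 1 (λ A → A :* con (+ 2) :+ con (+ 2) :* A := (con (+ 2) :+ con (+ 2)) :* A) refl

even-or-odd : ∀ t → ∃[ k ] (t ≡ k ℕ.* 2 ⊎ t ≡ suc (k ℕ.* 2))
even-or-odd zero = 0 , inj₁ ≡.refl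
even-or-odd (suc t) with even-or-odd t
... | k , inj₁ ≡.refl = k , inj₂ ≡.refl
... | k , inj₂ ≡.refl = suc k , inj₁ ≡.refl

[1+k*2]/2≡k : ∀ k → suc (k ℕ.* 2) / 2 ≡ k
[1+k*2]/2≡k k = ≡.trans (+-distrib-/-∣ʳ 1 {d = 2} (divides-refl k)) (m*n/n≡m k 2)

[2+k*2]/2≡1+k : ∀ k → suc (suc (k ℕ.* 2)) / 2 ≡ suc k
[2+k*2]/2≡1+k k = m*n/n≡m (suc k) 2

corollary1p4 : ∀ {c ℓ : Level} (R : CommutativeRing c ℓ) (A : CommutativeRing.Carrier R) (n : ℕ) → 2 ≤ n →
    let open CommutativeRing R in
    let D = det R n (λ j k → lucasV R A (- 1#) ∣ toℕ j - toℕ k ∣) in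
    let C = negOnePow R ((n ∸ 1) / 2) * pow R ((1# + 1#) * A) (n ∸ 2) in
    (n % 2 ≡ 1 → D ≈ C * (((1# + 1#) + (1# + 1#)) * A))
    × (n % 2 ≡ 0 → D ≈ C * (((1# + 1#) + (1# + 1#)) - A * A))
corollary1p4 R A (suc (suc t)) (s≤s (s≤s z≤n)) with even-or-odd t
... | k , inj₁ ≡.refl rewrite [1+k*2]/2≡k k =
  (λ n-odd → contradiction (≡.trans (≡.sym (m*n%n≡0 k 2)) n-odd) λ ()) , λ _ → LucasToeplitz.detT-even R A k
... | k , inj₂ ≡.refl rewrite [2+k*2]/2≡1+k k =
  (λ _ → LucasToeplitz.detT-odd R A k) , λ n-even → contradiction (≡.trans (≡.sym ([m+kn]%n≡m%n 1 k 2)) n-even) λ ()
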